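{- For every integer $n \ge 1$, $\mu_t(ST_3^n) = 3$. Moreover, a set $M \subseteq V(ST_3^n)$ is a total mutual-visibility set of $ST_3^n$ of cardinality $\mu_t(ST_3^n)$ if and only if $M = X(ST_3^n)$.
   Context: Sierpiński triangle graphs are defined recursively: $ST_3^0 = K_3$, whose three vertices are its extreme vertices, called top, left and right. For $n \ge 0$, $ST_3^{n+1}$ is obtained from three disjoint copies $T, L, R$ of $ST_3^n$ by identifying the left extreme vertex of $T$ with the top extreme vertex of $L$, the right extreme vertex of $T$ with the top extreme vertex of $R$, and the right extreme vertex of $L$ with the left extreme vertex of $R$; the extreme vertices of $ST_3^{n+1}$ are the top vertex of $T$, the left vertex of $L$ and the right vertex of $R$. $X(ST_3^n)$ denotes the set of the three extreme vertices of $ST_3^n$. For a graph $G$ and $M \subseteq V(G)$, vertices $u,v$ are $M$-visible if some shortest $u,v$-path in $G$ contains no vertex of $M \setminus \{u,v\}$. $M$ is a total mutual-visibility set of $G$ if every two vertices $u,v \in V(G)$ are $M$-visible. $\mu_t(G)$ is the largest cardinality of a total mutual-visibility set of $G$. -}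

module Defs where

open import Data.Nat using (ℕ; zero; suc; _≤_)
open import Data.Empty using (⊥)
open import Data.Sum using (_⊎_; inj₁; inj₂)
open import Data.Product using (Σ; ∃; ∃-syntax; _×_; _,_)
open import Data.List using (List; []; _∷_; length)
open import Data.List.Membership.Propositional using (_∈_)
open import Data.List.Relation.Unary.Unique.Propositional using (Unique)
open import Relation.Binary.PropositionalEquality using (_≡_; _≢_)
open import Function.Bundles using (_⇔_)

record Graph : Set₁ where
  field
    Vertex : Set
    Adj    : Vertex → Vertex → Set

module _ (G : Graph) where
  open Graph G

  data Walk : Vertex → Vertex → Set where
    [_]    : (u : Vertex) → Walk u u
    _∷⟨_⟩_ : ∀ {w v} (u : Vertex) → Adj u w → Walk w v → Walk u v

  len : ∀ {u v} → Walk u v → ℕ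
  len [ u ]          = zero
  len (u ∷⟨ e ⟩ p)   = suc (len p)

  verts : ∀ {u v} → Walk u v → List Vertex
  verts [ u ]        = u ∷ []
  verts (u ∷⟨ e ⟩ p) = u ∷ verts p

  -- a shortest u,v-path: a u,v-walk of minimum length (such a walk is a path)
  IsShortest : ∀ {u v} → Walk u v → Set
  IsShortest {u} {v} P = (Q : Walk u v) → len P ≤ len Q

  Visible : List Vertex → Vertex → Vertex → Set
  Visible M u v =
    Σ (Walk u v) λ P → IsShortest P ×
      ((x : Vertex) → x ∈ verts P → x ∈ M → (x ≡ u) ⊎ (x ≡ v))

  -- M is a total mutual-visibility set of G
  -- (vertex subsets are represented by duplicate-free lists)
  IsTotalMV : List Vertex → Set
  IsTotalMV M = (u v : Vertex) → Visible M u v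

  IsMuT : ℕ → Set
  IsMuT k =
    (Σ (List Vertex) λ M → Unique M × IsTotalMV M × length M ≡ k) ×
    ((M : List Vertex) → Unique M → IsTotalMV M → length M ≤ k)

-- the three positions: top, left, right (used both for extreme vertices
-- and for the three copies T, L, R)
data Pos : Set where
  top left right : Pos

-- non-extreme vertices of ST_3^n
--   ST_3^0 = K_3 has none;
--   ST_3^{n+1}: a non-extreme vertex of one of the copies T, L, R,
--   or one of the three identified vertices; the identified vertex
--   is indexed by the copy NOT containing it:
--     glue right = (left of T) = (top of L)
--     glue left  = (right of T) = (top of R)
--     glue top   = (right of L) = (left of R)
data Inner : ℕ → Set where
  copy : ∀ {n} → Pos → Inner n → Inner (suc n)
  glue : ∀ {n} → Pos → Inner (suc n)

data V (n : ℕ) : Set where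
  ext   : Pos → V n
  inner : Inner n → V n

emb : ∀ {n} → Pos → V n → V (suc n)
emb c     (inner x)   = inner (copy c x)
emb top   (ext top)   = ext top
emb top   (ext left)  = inner (glue right)
emb top   (ext right) = inner (glue left)
emb left  (ext top)   = inner (glue right)
emb left  (ext left)  = ext left
emb left  (ext right) = inner (glue top)
emb right (ext top)   = inner (glue left)
emb right (ext left)  = inner (glue top)
emb right (ext right) = ext right

STAdj : (n : ℕ) → V n → V n → Set
STAdj zero    (ext p)   (ext q)   = p ≢ q
STAdj zero    (ext p)   (inner ())
STAdj zero    (inner ()) _
STAdj (suc n) a b =
  ∃[ c ] ∃[ u ] ∃[ w ] (STAdj n u w × emb c u ≡ a × emb c w ≡ b)

ST : ℕ → Graph
ST n = record { Vertex = V n ; Adj = STAdj n }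

extremes : (n : ℕ) → List (V n)
extremes n = ext top ∷ ext left ∷ ext right ∷ []

{-# OPTIONS --safe #-}

-- The extreme vertices of ST_3^n are simplicial (their neighbours are pairwise adjacent), so
-- no shortest path passes through one of them and X(ST_3^n) is a total mutual-visibility set.
-- Every other vertex z is the unique common neighbour of two non-adjacent vertices a and c:
-- for a vertex where two copies are glued take a neighbour of it in each copy, and for a vertex
-- inside a copy lift the pair found in that copy. Then a, z, c is the only shortest a,c-path,
-- so z lies in no total mutual-visibility set. Hence the total mutual-visibility sets are
-- exactly the subsets of X(ST_3^n).

module Submission where

open import Defs
open import Data.Nat using (ℕ; zero; suc; _≤_; _<_; z≤n; s≤s)
open import Data.Nat.Properties
  using (≤-refl; ≤-reflexive; ≤-trans; ≤-antisym; ≤-pred; n≤1+n; <⇒≱; ≮⇒≥; <-irrefl)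
open import Data.Product using (_×_; Σ; Σ-syntax; ∃; ∃₂; _,_; proj₁; proj₂)
open import Data.Sum using (_⊎_; inj₁; inj₂)
open import Data.Empty using (⊥; ⊥-elim)
open import Data.List using (List; []; _∷_; length; filter)
open import Data.List.Properties using (length-filter; filter-notAll)
open import Data.List.Membership.Propositional using (_∈_; _∉_; lose)
open import Data.List.Membership.Propositional.Properties using (∈-filter⁺; ∈-filter⁻)
open import Data.List.Membership.Propositional.Properties.WithK using (unique∧set⇒bag)
import Data.List.Membership.DecPropositional as DecMembership
open import Data.List.Relation.Binary.BagAndSetEquality using (∼bag⇒↭)
open import Data.List.Relation.Binary.Permutation.Propositional using (_↭_)
open import Data.List.Relation.Binary.Permutation.Propositional.Properties using (↭-length)
open import Data.List.Relation.Binary.Subset.Propositional using (_⊆_)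
open import Data.List.Relation.Unary.All using ([]; _∷_)
open import Data.List.Relation.Unary.Any using (here; there)
open import Data.List.Relation.Unary.AllPairs using ([]; _∷_)
open import Data.List.Relation.Unary.Unique.Propositional using (Unique)
import Data.List.Relation.Unary.Unique.Propositional.Properties as Unique
open import Function using (_∘_)
open import Function.Bundles using (_⇔_; mk⇔; Equivalence)
open import Relation.Binary.Definitions using (Decidable; DecidableEquality)
open import Relation.Binary.PropositionalEquality using (_≡_; _≢_; refl; sym; trans; cong; subst)
open import Relation.Nullary using (Dec; yes; no; ¬_)
open import Relation.Nullary.Decidable
  using (map′; from-yes; ¬?; _×-dec_; _⊎-dec_; _→-dec_)
import Relation.Unary as U

module _ {A : Set} (_≟_ : DecidableEquality A) {xs ys : List A}
         (xs! : Unique xs) (ys! : Unique ys) (xs⊆ys : xs ⊆ ys) where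
  open DecMembership _≟_ using (_∈?_)

  ↭-filter-∈ : xs ↭ filter (_∈? xs) ys
  ↭-filter-∈ = ∼bag⇒↭ (unique∧set⇒bag xs! (Unique.filter⁺ (_∈? xs) ys!)
    (mk⇔ (λ x∈xs → ∈-filter⁺ (_∈? xs) (xs⊆ys x∈xs) x∈xs)
         (proj₂ ∘ ∈-filter⁻ (_∈? xs) {xs = ys})))

  unique-⊆⇒length-≤ : length xs ≤ length ys
  unique-⊆⇒length-≤ = ≤-trans (≤-reflexive (↭-length ↭-filter-∈)) (length-filter (_∈? xs) ys)

  unique-⊆∧length-≡⇒⊇ : length xs ≡ length ys → ys ⊆ xs
  unique-⊆∧length-≡⇒⊇ |xs|≡|ys| {y} y∈ys with y ∈? xs
  ... | yes y∈xs = y∈xs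
  ... | no y∉xs = ⊥-elim (<-irrefl |xs|≡|ys|
    (subst (_< length ys) (sym (↭-length ↭-filter-∈)) (filter-notAll (_∈? xs) ys (lose y∈ys y∉xs))))

Searchable : Set → Set₁
Searchable A = {P : A → Set} → U.Decidable P → Dec (∃ P)

module _ {G : Graph} where
  open Graph G

  _++ʷ_ : ∀ {u w v} → Walk G u w → Walk G w v → Walk G u v
  [ _ ] ++ʷ Q = Q
  (u ∷⟨ a ⟩ P) ++ʷ Q = u ∷⟨ a ⟩ (P ++ʷ Q)

  Simplicial : Vertex → Set
  Simplicial e = ∀ {a b} → Adj a e → Adj e b → a ≡ b ⊎ Adj a b

  bypass-simplicial : ∀ {e u w v} → Simplicial e → (a : Adj u w) (P : Walk G w v) →
                      e ∈ verts G P → e ≢ v → Σ[ Q ∈ Walk G u v ] len G Q < len G (u ∷⟨ a ⟩ P)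
  bypass-simplicial s a [ _ ] (here refl) e≢v = ⊥-elim (e≢v refl)
  bypass-simplicial s a (_ ∷⟨ b ⟩ P) (here refl) _ with s a b
  ... | inj₁ refl = P , s≤s (n≤1+n _)
  ... | inj₂ a′ = (_ ∷⟨ a′ ⟩ P) , ≤-refl
  bypass-simplicial s a (_ ∷⟨ b ⟩ P) (there e∈P) e≢v with bypass-simplicial s b P e∈P e≢v
  ... | Q , Q<P = (_ ∷⟨ a ⟩ Q) , s≤s Q<P

  shortest-avoids-simplicial : ∀ {e u v} {P : Walk G u v} → IsShortest G P → Simplicial e →
                               e ∈ verts G P → e ≢ u → e ≢ v → ⊥
  shortest-avoids-simplicial {P = [ _ ]} _ _ (here refl) e≢u _ = e≢u refl
  shortest-avoids-simplicial {P = _ ∷⟨ _ ⟩ _} _ _ (here refl) e≢u _ = e≢u refl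
  shortest-avoids-simplicial {P = _ ∷⟨ a ⟩ P} P-min s (there e∈P) _ e≢v
    with Q , Q<P ← bypass-simplicial s a P e∈P e≢v = <⇒≱ Q<P (P-min Q)

  simplicial-totalMV : DecidableEquality Vertex → (∀ u v → Σ (Walk G u v) (IsShortest G)) →
                       (M : List Vertex) → (∀ {x} → x ∈ M → Simplicial x) → IsTotalMV G M
  simplicial-totalMV _≟_ shortest M M-simplicial u v with P , P-min ← shortest u v =
    P , P-min , avoids
    where
    avoids : ∀ x → x ∈ verts G P → x ∈ M → x ≡ u ⊎ x ≡ v
    avoids x x∈P x∈M with x ≟ u | x ≟ v
    ... | yes x≡u | _ = inj₁ x≡u
    ... | no _ | yes x≡v = inj₂ x≡v
    ... | no x≢u | no x≢v =
      ⊥-elim (shortest-avoids-simplicial P-min (M-simplicial x∈M) x∈P x≢u x≢v)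

  totalMV-⊆ : ∀ {M M′} → M ⊆ M′ → IsTotalMV G M′ → IsTotalMV G M
  totalMV-⊆ M⊆M′ M′-tmv u v with P , P-min , P-avoids ← M′-tmv u v =
    P , P-min , λ x x∈P x∈M → P-avoids x x∈P (M⊆M′ x∈M)

  record UniqueMidpoint (a z c : Vertex) : Set where
    field
      adjˡ             : Adj a z
      adjʳ             : Adj z c
      ends-distinct    : a ≢ c
      ends-nonadjacent : ¬ Adj a c
      unique           : ∀ {y} → Adj a y → Adj y c → y ≡ z

  IsUniqueMidpoint : Vertex → Set
  IsUniqueMidpoint z = ∃₂ λ a c → UniqueMidpoint a z c

  uniqueMidpoint-blocks : ∀ {a z c M} → UniqueMidpoint a z c → z ∈ M → ¬ Visible G M a c
  uniqueMidpoint-blocks {a} {z} {c} {M} mid z∈M (P , P-min , P-avoids) =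
    short-walk-avoids P (P-min (a ∷⟨ adjˡ ⟩ (z ∷⟨ adjʳ ⟩ [ c ]))) (P-avoids z)
    where
    open UniqueMidpoint mid
    short-walk-avoids : (P : Walk G a c) → len G P ≤ 2 →
                        (z ∈ verts G P → z ∈ M → z ≡ a ⊎ z ≡ c) → ⊥
    short-walk-avoids [ _ ] _ _ = ends-distinct refl
    short-walk-avoids (_ ∷⟨ a~c ⟩ [ _ ]) _ _ = ends-nonadjacent a~c
    short-walk-avoids (_ ∷⟨ a~y ⟩ (_ ∷⟨ y~c ⟩ [ _ ])) _ P-avoids-z
      with refl ← unique a~y y~c | P-avoids-z (there (here refl)) z∈M
    ... | inj₁ refl = ends-nonadjacent adjʳ
    ... | inj₂ refl = ends-nonadjacent adjˡ
    short-walk-avoids (_ ∷⟨ _ ⟩ (_ ∷⟨ _ ⟩ (_ ∷⟨ _ ⟩ _))) (s≤s (s≤s ())) _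

  uniqueMidpoint-∉-totalMV : ∀ {z M} → IsUniqueMidpoint z → IsTotalMV G M → z ∉ M
  uniqueMidpoint-∉-totalMV (a , c , mid) M-tmv z∈M = uniqueMidpoint-blocks mid z∈M (M-tmv a c)

  module _ (_≟_ : DecidableEquality Vertex) (adj? : Decidable Adj) (search : Searchable Vertex)
    where

    walk≤? : ∀ k u v → Dec (Σ[ P ∈ Walk G u v ] len G P ≤ k)
    walk≤? k u v with u ≟ v
    ... | yes refl = yes ([ u ] , z≤n)
    walk≤? zero u v | no u≢v = no λ { ([ _ ] , _) → u≢v refl ; ((_ ∷⟨ _ ⟩ _) , ()) }
    walk≤? (suc k) u v | no u≢v with search (λ w → adj? u w ×-dec walk≤? k w v)
    ... | yes (_ , a , P , P≤k) = yes ((u ∷⟨ a ⟩ P) , s≤s P≤k)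
    ... | no ∄ = no λ { ([ _ ] , _) → u≢v refl
                      ; ((_ ∷⟨ a ⟩ P) , s≤s P≤k) → ∄ (_ , a , P , P≤k) }

    shortest-below : ∀ {u v} k → Σ[ P ∈ Walk G u v ] len G P ≤ k → Σ (Walk G u v) (IsShortest G)
    shortest-below zero (P , P≤0) = P , λ Q → ≤-trans P≤0 z≤n
    shortest-below {u} {v} (suc k) (P , P≤k+1) with walk≤? k u v
    ... | yes P′ = shortest-below k P′
    ... | no ∄ = P , λ Q → ≤-trans P≤k+1 (≮⇒≥ λ Q<k+1 → ∄ (Q , ≤-pred Q<k+1))

    shortest-walk : ∀ {u v} → Walk G u v → Σ (Walk G u v) (IsShortest G)
    shortest-walk P = shortest-below (len G P) (P , ≤-refl)

_≟ₚ_ : DecidableEquality Pos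
top   ≟ₚ top   = yes refl
top   ≟ₚ left  = no λ ()
top   ≟ₚ right = no λ ()
left  ≟ₚ top   = no λ ()
left  ≟ₚ left  = yes refl
left  ≟ₚ right = no λ ()
right ≟ₚ top   = no λ ()
right ≟ₚ left  = no λ ()
right ≟ₚ right = yes refl

_≟ⁱ_ : ∀ {n} → DecidableEquality (Inner n)
copy c x ≟ⁱ copy d y =
  map′ (λ { (refl , refl) → refl }) (λ { refl → refl , refl }) (c ≟ₚ d ×-dec x ≟ⁱ y)
copy _ _ ≟ⁱ glue _   = no λ ()
glue _   ≟ⁱ copy _ _ = no λ ()
glue p   ≟ⁱ glue q   = map′ (cong glue) (λ { refl → refl }) (p ≟ₚ q)

_≟_ : ∀ {n} → DecidableEquality (V n)
ext p   ≟ ext q   = map′ (cong ext) (λ { refl → refl }) (p ≟ₚ q)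
ext _   ≟ inner _ = no λ ()
inner _ ≟ ext _   = no λ ()
inner x ≟ inner y = map′ (cong inner) (λ { refl → refl }) (x ≟ⁱ y)

all-Pos? : {P : Pos → Set} → U.Decidable P → Dec (∀ p → P p)
all-Pos? P? = map′ (λ { (t , l , r) top → t ; (t , l , r) left → l ; (t , l , r) right → r })
                   (λ f → f top , f left , f right)
                   (P? top ×-dec P? left ×-dec P? right)

search-Pos : Searchable Pos
search-Pos P? =
  map′ (λ { (inj₁ t) → top , t ; (inj₂ (inj₁ l)) → left , l ; (inj₂ (inj₂ r)) → right , r })
       (λ { (top , t) → inj₁ t ; (left , l) → inj₂ (inj₁ l) ; (right , r) → inj₂ (inj₂ r) })
       (P? top ⊎-dec P? left ⊎-dec P? right)

search-Inner : ∀ n → Searchable (Inner n)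
search-Inner zero    _  = no λ { (() , _) }
search-Inner (suc n) P? =
  map′ (λ { (inj₁ (p , h)) → glue p , h ; (inj₂ (c , x , h)) → copy c x , h })
       (λ { (glue p , h) → inj₁ (p , h) ; (copy c x , h) → inj₂ (c , x , h) })
       (search-Pos (P? ∘ glue) ⊎-dec search-Pos λ c → search-Inner n (P? ∘ copy c))

search-V : ∀ n → Searchable (V n)
search-V n P? =
  map′ (λ { (inj₁ (p , h)) → ext p , h ; (inj₂ (x , h)) → inner x , h })
       (λ { (ext p , h) → inj₁ (p , h) ; (inner x , h) → inj₂ (x , h) })
       (search-Pos (P? ∘ ext) ⊎-dec search-Inner n (P? ∘ inner))

adj? : ∀ n → Decidable (STAdj n)
adj? zero    (ext p)    (ext q)    = ¬? (p ≟ₚ q)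
adj? zero    (ext _)    (inner ())
adj? zero    (inner ()) _
adj? (suc n) a          b          =
  search-Pos λ c → search-V n λ u → search-V n λ w →
    adj? n u w ×-dec emb c u ≟ a ×-dec emb c w ≟ b

emb-ext-self : ∀ {n} c → emb {n} c (ext c) ≡ ext c
emb-ext-self top   = refl
emb-ext-self left  = refl
emb-ext-self right = refl

-- _≟_ compares the corners emb c (ext p) without inspecting n, so these finite tables are
-- checked by evaluation uniformly in n.
emb-ext-comm : ∀ {n} c d → emb {n} c (ext d) ≡ emb d (ext c)
emb-ext-comm {n} = from-yes (all-Pos? λ c → all-Pos? λ d → emb {n} c (ext d) ≟ emb d (ext c))

emb-ext≢copy : ∀ {n} c (x : Inner n) d q → emb d (ext q) ≢ inner (copy c x)
emb-ext≢copy c x =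
  from-yes (all-Pos? λ d → all-Pos? λ q → ¬? (emb d (ext q) ≟ inner (copy c x)))

emb-ext-inv : ∀ {n} c d p q → emb {n} c (ext p) ≡ emb d (ext q) →
              (c ≡ d × p ≡ q) ⊎ (c ≢ d × p ≡ d × q ≡ c)
emb-ext-inv {n} = from-yes (all-Pos? λ c → all-Pos? λ d → all-Pos? λ p → all-Pos? λ q →
  emb {n} c (ext p) ≟ emb d (ext q) →-dec
    ((c ≟ₚ d ×-dec p ≟ₚ q) ⊎-dec (¬? (c ≟ₚ d) ×-dec p ≟ₚ d ×-dec q ≟ₚ c)))

emb-inv : ∀ {n} c d (u w : V n) → emb c u ≡ emb d w →
          (c ≡ d × u ≡ w) ⊎ (c ≢ d × u ≡ ext d × w ≡ ext c)
emb-inv c d (inner x) (inner y) refl = inj₁ (refl , refl)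
emb-inv c d (inner x) (ext q)   eq   = ⊥-elim (emb-ext≢copy c x d q (sym eq))
emb-inv c d (ext p)   (inner y) eq   = ⊥-elim (emb-ext≢copy d y c p eq)
emb-inv c d (ext p)   (ext q)   eq   with emb-ext-inv c d p q eq
... | inj₁ (c≡d , refl)        = inj₁ (c≡d , refl)
... | inj₂ (c≢d , refl , refl) = inj₂ (c≢d , refl , refl)

emb-injective : ∀ {n} c {u w : V n} → emb c u ≡ emb c w → u ≡ w
emb-injective c {u} {w} eq with emb-inv c c u w eq
... | inj₁ (_ , u≡w)   = u≡w
... | inj₂ (c≢c , _) = ⊥-elim (c≢c refl)

emb≡ext : ∀ {n} d (w : V n) c → emb d w ≡ ext c → d ≡ c × w ≡ ext c
emb≡ext d w c eq with emb-inv d c w (ext c) (trans eq (sym (emb-ext-self c)))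
... | inj₁ d≡c,w≡c           = d≡c,w≡c
... | inj₂ (d≢c , _ , refl) = ⊥-elim (d≢c refl)

emb-surjective : ∀ {n} (v : V (suc n)) → ∃₂ λ c x → emb c x ≡ v
emb-surjective (ext p)             = p , ext p , emb-ext-self p
emb-surjective (inner (copy c x))  = c , inner x , refl
emb-surjective (inner (glue top))   = left , ext right , refl
emb-surjective (inner (glue left))  = top , ext right , refl
emb-surjective (inner (glue right)) = top , ext left , refl

emb-adj : ∀ {n} c {u w : V n} → STAdj n u w → STAdj (suc n) (emb c u) (emb c w)
emb-adj c u~w = c , _ , _ , u~w , refl , refl

emb-walk : ∀ {n} c {u v} → Walk (ST n) u v → Walk (ST (suc n)) (emb c u) (emb c v)
emb-walk c [ u ]         = [ emb c u ]
emb-walk c (u ∷⟨ a ⟩ P) = emb c u ∷⟨ emb-adj c a ⟩ emb-walk c P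

connected : ∀ n (u v : V n) → Walk (ST n) u v
connected zero    (ext p)    (ext q)    with p ≟ₚ q
... | yes refl = [ ext p ]
... | no p≢q   = ext p ∷⟨ p≢q ⟩ [ ext q ]
connected zero    (ext _)    (inner ())
connected zero    (inner ()) _
connected (suc n) u v
  with c , x , refl ← emb-surjective u | d , y , refl ← emb-surjective v =
  emb-walk c (connected n x (ext d)) ++ʷ
  subst (λ z → Walk (ST (suc n)) z (emb d y)) (emb-ext-comm d c)
        (emb-walk d (connected n (ext c) y))

STAdj-irrefl : ∀ n {a} → ¬ STAdj n a a
STAdj-irrefl zero    {ext p} p≢p = p≢p refl
STAdj-irrefl zero    {inner ()}
STAdj-irrefl (suc n) (c , u , w , u~w , refl , eq) with refl ← emb-injective c eq =
  STAdj-irrefl n u~w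

STAdj-sym : ∀ n {a b} → STAdj n a b → STAdj n b a
STAdj-sym zero    {ext _}    {ext _}    p≢q = p≢q ∘ sym
STAdj-sym zero    {ext _}    {inner ()}
STAdj-sym zero    {inner ()}
STAdj-sym (suc n) (c , u , w , u~w , eq₁ , eq₂) = c , w , u , STAdj-sym n u~w , eq₂ , eq₁

ext-nonadjacent : ∀ n p q → ¬ STAdj (suc n) (ext p) (ext q)
ext-nonadjacent n p q (c , u , w , u~w , eq₁ , eq₂)
  with refl , refl ← emb≡ext c u p eq₁ | refl , refl ← emb≡ext c w q eq₂ = STAdj-irrefl n u~w

emb-adj-view : ∀ {n} d {u : V n} {y} → STAdj (suc n) (emb d u) y →
               (∃ λ w → emb d w ≡ y × STAdj n u w) ⊎
               (∃₂ λ e w → e ≢ d × u ≡ ext e × emb e w ≡ y × STAdj n (ext d) w)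
emb-adj-view d {u} (e , u′ , w , u′~w , eq₁ , eq₂) with emb-inv e d u′ u eq₁
... | inj₁ (refl , refl)          = inj₁ (w , eq₂ , u′~w)
... | inj₂ (e≢d , refl , u≡ext-e) = inj₂ (e , w , e≢d , u≡ext-e , eq₂ , u′~w)

corner-edge-leaves-copy : ∀ {n} d f {w₁ w₂ : V n} → f ≢ d → STAdj n (ext d) w₂ →
                          emb f w₂ ≢ emb d w₁
corner-edge-leaves-copy d f f≢d d~w₂ eq with emb-inv f d _ _ eq
... | inj₁ (f≡d , _)     = f≢d f≡d
... | inj₂ (_ , refl , _) = STAdj-irrefl _ d~w₂

emb-adj⁻ : ∀ {n} d {u w : V n} → STAdj (suc n) (emb d u) (emb d w) → STAdj n u w
emb-adj⁻ d u~w with emb-adj-view d u~w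
... | inj₁ (_ , eq , u~w′) with refl ← emb-injective d eq = u~w′
... | inj₂ (e , _ , e≢d , _ , eq , d~w′) = ⊥-elim (corner-edge-leaves-copy d e e≢d d~w′ eq)

ext-simplicial : ∀ n p → Simplicial {ST n} (ext p)
ext-simplicial zero    p {ext a} {ext b} _ _ with a ≟ₚ b
... | yes refl = inj₁ refl
... | no a≢b   = inj₂ a≢b
ext-simplicial zero    p {ext _} {inner ()}
ext-simplicial zero    p {inner ()}
ext-simplicial (suc n) p (c , u , w , u~w , refl , eq₂) (c′ , u′ , w′ , u′~w′ , eq₁′ , refl)
  with refl , refl ← emb≡ext c w p eq₂ | refl , refl ← emb≡ext c′ u′ p eq₁′
  with ext-simplicial n p u~w u′~w′
... | inj₁ refl  = inj₁ refl
... | inj₂ u~w′ = inj₂ (emb-adj p u~w′)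

extremes-simplicial : ∀ n {x} → x ∈ extremes n → Simplicial {ST n} x
extremes-simplicial n (here refl)                 = ext-simplicial n top
extremes-simplicial n (there (here refl))         = ext-simplicial n left
extremes-simplicial n (there (there (here refl))) = ext-simplicial n right

extremes-totalMV : ∀ n → IsTotalMV (ST n) (extremes n)
extremes-totalMV n = simplicial-totalMV _≟_ shortest (extremes n) (extremes-simplicial n)
  where
  shortest : ∀ u v → Σ (Walk (ST n) u v) (IsShortest (ST n))
  shortest u v = shortest-walk _≟_ (adj? n) (search-V n) (connected n u v)

neighbour : ∀ n → Pos → Pos → V n
neighbour zero    r q = ext q
neighbour (suc n) r q = emb r (neighbour n r q)

neighbour-adj : ∀ n {r q} → r ≢ q → STAdj n (ext r) (neighbour n r q)
neighbour-adj zero    r≢q       = r≢q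
neighbour-adj (suc n) {r} r≢q = r , ext r , _ , neighbour-adj n r≢q , emb-ext-self r , refl

AvoidsExtremesBut : ∀ {n} → Pos → V n → Set
AvoidsExtremesBut q u = ∀ {s} → u ≡ ext s → s ≡ q

neighbour-avoids : ∀ n {r q} → r ≢ q → AvoidsExtremesBut q (neighbour n r q)
neighbour-avoids zero    _   refl = refl
neighbour-avoids (suc n) r≢q eq with refl , neighbour≡ext ← emb≡ext _ _ _ eq =
  ⊥-elim (STAdj-irrefl n (subst (STAdj n _) neighbour≡ext (neighbour-adj n r≢q)))

emb-avoids-unique : ∀ {n} q {a : V n} → AvoidsExtremesBut q a →
                    ∀ {d u} → emb d u ≡ emb q a → d ≡ q × u ≡ a
emb-avoids-unique q {a} avoids {d} {u} eq with emb-inv d q u a eq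
... | inj₁ d≡q,u≡a              = d≡q,u≡a
... | inj₂ (d≢q , _ , a≡ext-d) = ⊥-elim (d≢q (avoids a≡ext-d))

emb-avoids-adj : ∀ {n} q {a : V n} → AvoidsExtremesBut q a →
                 ∀ {y} → STAdj (suc n) (emb q a) y → ∃ λ w → emb q w ≡ y × STAdj n a w
emb-avoids-adj q avoids a~y with emb-adj-view q a~y
... | inj₁ in-copy                      = in-copy
... | inj₂ (_ , _ , e≢q , a≡ext-e , _) = ⊥-elim (e≢q (avoids a≡ext-e))

glue-midpoint : ∀ n {q r} → q ≢ r → IsUniqueMidpoint {ST (suc n)} (emb q (ext r))
glue-midpoint n {q} {r} q≢r = emb q a , emb r c , record
  { adjˡ             = emb-adj q (STAdj-sym n (neighbour-adj n (q≢r ∘ sym)))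
  ; adjʳ             = r , ext q , c , neighbour-adj n q≢r , emb-ext-comm r q , refl
  ; ends-distinct    = q≢r ∘ copy-of-c
  ; ends-nonadjacent = nonadjacent
  ; unique           = unique
  }
  where
  -- a lies in copy q only and c in copy r only, so a common neighbour lies in both copies.
  a c : V n
  a = neighbour n r q
  c = neighbour n q r
  a-avoids : AvoidsExtremesBut q a
  a-avoids = neighbour-avoids n (q≢r ∘ sym)
  c-avoids : AvoidsExtremesBut r c
  c-avoids = neighbour-avoids n q≢r
  copy-of-c : ∀ {u} → emb q u ≡ emb r c → q ≡ r
  copy-of-c eq = proj₁ (emb-avoids-unique r c-avoids eq)
  nonadjacent : ¬ STAdj (suc n) (emb q a) (emb r c)
  nonadjacent a~c with _ , eq , _ ← emb-avoids-adj q a-avoids a~c = q≢r (copy-of-c eq)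
  unique : ∀ {y} → STAdj (suc n) (emb q a) y → STAdj (suc n) y (emb r c) → y ≡ emb q (ext r)
  unique a~y y~c
    with w₁ , refl , _ ← emb-avoids-adj q a-avoids a~y
       | w₂ , eq₂ , _ ← emb-avoids-adj r c-avoids (STAdj-sym (suc n) y~c)
    with emb-inv q r w₁ w₂ (sym eq₂)
  ... | inj₁ (q≡r , _)     = ⊥-elim (q≢r q≡r)
  ... | inj₂ (_ , refl , _) = refl

-- The copies must have level ≥ 1: in ST_3^1 the vertex glue top is a common neighbour of the
-- two corners of the copy T other than its top.
common-neighbour-in-copy : ∀ m d {a c : V (suc m)} → a ≢ c → ∀ {y} →
                           STAdj (suc (suc m)) (emb d a) y → STAdj (suc (suc m)) y (emb d c) →
                           ∃ λ y′ → emb d y′ ≡ y × STAdj (suc m) a y′ × STAdj (suc m) y′ c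
common-neighbour-in-copy m d a≢c a~y y~c
  with emb-adj-view d a~y | emb-adj-view d (STAdj-sym (suc (suc m)) y~c)
... | inj₁ (w₁ , refl , a~w₁) | inj₁ (w₂ , eq , c~w₂) with refl ← emb-injective d eq =
  w₁ , refl , a~w₁ , STAdj-sym (suc m) c~w₂
... | inj₁ (_ , refl , _) | inj₂ (f , _ , f≢d , _ , eq , d~w₂) =
  ⊥-elim (corner-edge-leaves-copy d f f≢d d~w₂ eq)
... | inj₂ (e , _ , e≢d , _ , refl , d~w₁) | inj₁ (_ , eq , _) =
  ⊥-elim (corner-edge-leaves-copy d e e≢d d~w₁ (sym eq))
... | inj₂ (e , w₁ , _ , refl , refl , d~w₁) | inj₂ (f , w₂ , _ , refl , eq , _)
  with emb-inv f e w₂ w₁ eq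
...   | inj₁ (refl , _)     = ⊥-elim (a≢c refl)
...   | inj₂ (_ , _ , refl) = ⊥-elim (ext-nonadjacent m d f d~w₁)

copy-midpoint : ∀ m d {z : V (suc m)} → IsUniqueMidpoint {ST (suc m)} z →
                IsUniqueMidpoint {ST (suc (suc m))} (emb d z)
copy-midpoint m d {z} (a , c , mid) = emb d a , emb d c , record
  { adjˡ             = emb-adj d adjˡ
  ; adjʳ             = emb-adj d adjʳ
  ; ends-distinct    = ends-distinct ∘ emb-injective d
  ; ends-nonadjacent = ends-nonadjacent ∘ emb-adj⁻ d
  ; unique           = unique-in-copy
  }
  where
  open UniqueMidpoint mid
  unique-in-copy : ∀ {y} → STAdj (suc (suc m)) (emb d a) y → STAdj (suc (suc m)) y (emb d c) →
                   y ≡ emb d z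
  unique-in-copy a~y y~c
    with y′ , refl , a~y′ , y′~c ← common-neighbour-in-copy m d ends-distinct a~y y~c =
    cong (emb d) (unique a~y′ y′~c)

inner-midpoint : ∀ n (x : Inner n) → IsUniqueMidpoint {ST n} (inner x)
inner-midpoint (suc n)       (glue top)   = glue-midpoint n {left} {right} λ ()
inner-midpoint (suc n)       (glue left)  = glue-midpoint n {top} {right} λ ()
inner-midpoint (suc n)       (glue right) = glue-midpoint n {top} {left} λ ()
inner-midpoint (suc (suc m)) (copy d x)   = copy-midpoint m d (inner-midpoint (suc m) x)

totalMV⊆extremes : ∀ n {M} → IsTotalMV (ST n) M → M ⊆ extremes n
totalMV⊆extremes n _     {ext top}   _   = here refl
totalMV⊆extremes n _     {ext left}  _   = there (here refl)
totalMV⊆extremes n _     {ext right} _   = there (there (here refl))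
totalMV⊆extremes n M-tmv {inner x}   x∈M =
  ⊥-elim (uniqueMidpoint-∉-totalMV (inner-midpoint n x) M-tmv x∈M)

extremes-unique : ∀ n → Unique (extremes n)
extremes-unique n = ((λ ()) ∷ (λ ()) ∷ []) ∷ ((λ ()) ∷ []) ∷ [] ∷ []

theorem4 : (n : ℕ) → 1 ≤ n →
    IsMuT (ST n) 3 ×
    ((M : List (V n)) → Unique M →
      ((IsTotalMV (ST n) M × length M ≡ 3) ⇔ ((x : V n) → (x ∈ M) ⇔ (x ∈ extremes n))))
theorem4 n _ = (maximum , upper-bound) , characterisation
  where
  X! : Unique (extremes n)
  X! = extremes-unique n
  maximum : Σ (List (V n)) λ M → Unique M × IsTotalMV (ST n) M × length M ≡ 3
  maximum = extremes n , X! , extremes-totalMV n , refl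
  upper-bound : (M : List (V n)) → Unique M → IsTotalMV (ST n) M → length M ≤ 3
  upper-bound M M! M-tmv = unique-⊆⇒length-≤ _≟_ M! X! (totalMV⊆extremes n M-tmv)
  characterisation : (M : List (V n)) → Unique M →
    (IsTotalMV (ST n) M × length M ≡ 3) ⇔ ((x : V n) → (x ∈ M) ⇔ (x ∈ extremes n))
  characterisation M M! = mk⇔ to from
    where
    to : IsTotalMV (ST n) M × length M ≡ 3 → (x : V n) → (x ∈ M) ⇔ (x ∈ extremes n)
    to (M-tmv , |M|≡3) _ = mk⇔ M⊆X (unique-⊆∧length-≡⇒⊇ _≟_ M! X! M⊆X |M|≡3)
      where
      M⊆X : M ⊆ extremes n
      M⊆X = totalMV⊆extremes n M-tmv
    from : ((x : V n) → (x ∈ M) ⇔ (x ∈ extremes n)) → IsTotalMV (ST n) M × length M ≡ 3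
    from M⇔X = totalMV-⊆ M⊆X (extremes-totalMV n) ,
               ≤-antisym (unique-⊆⇒length-≤ _≟_ M! X! M⊆X) (unique-⊆⇒length-≤ _≟_ X! M! X⊆M)
      where
      M⊆X : M ⊆ extremes n
      M⊆X = Equivalence.to (M⇔X _)
      X⊆M : extremes n ⊆ M
      X⊆M = Equivalence.from (M⇔X _)
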